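{- Let $v$ be even, let $X$ be a set of $v$ points partitioned into two parts $X_1,X_2$ of size $n=v/2$, let $k\ge 4$ be even with $n\ge k$, and let $h=k/2$. Suppose that on $X_1$ there is a resolvable $(n,h,2)$ covering design with parallel classes $\mathcal{P}_1,\ldots,\mathcal{P}_p$ and on $X_2$ a resolvable $(n,h,2)$ covering design with parallel classes $\mathcal{R}_1,\ldots,\mathcal{R}_p$, where $p\le 5$. For $i=1,2$ let $(X_i,\mathcal{B}_i)$ be an $(n,k,4)$ covering design. Define $$\mathcal{B}=\mathcal{B}_1\cup\mathcal{B}_2\cup\bigcup_{i=1}^p\mathcal{P}_i\mathcal{R}_i.$$ Then $(X,\mathcal{B})$ is a $(v,k,4,6)$ cover.
   Context: A $(v,k,t,m)$ cover is a pair $(X,\mathcal{B})$ with $|X|=v$ and $\mathcal{B}$ a collection of $k$-subsets of $X$ such that every $m$-subset of $X$ meets some block in at least $t$ points; a $(v,k,t)$ covering design is a $(v,k,t,t)$ cover (every $t$-subset lies in some block). A $(v,k,t)$ covering design is resolvable if its blocks can be partitioned into parallel classes, each of which is a partition of the point set. For collections $\mathcal{A},\mathcal{B}$, $\mathcal{A}\mathcal{B}=\{A\cup B: A\in\mathcal{A},B\in\mathcal{B}\}$. -}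

module Defs where

open import Data.Nat using (ℕ; _≤_)
open import Data.Fin using (Fin)
open import Data.Fin.Subset using (Subset; ∣_∣; _⊆_; _∩_; _∈_; ⊥)
open import Data.Vec as Vec using (Vec; _++_)
open import Data.List as List using (List; length; lookup; cartesianProductWith; concat)
import Data.List.Membership.Propositional as LMem
open import Data.List.Relation.Unary.All using (All)
open import Data.Product using (Σ; ∃; _×_)
open import Relation.Binary.PropositionalEquality using (_≡_)

-- A collection of blocks on the point set Fin v is a list of subsets (multiset).
Blocks : ℕ → Set
Blocks v = List (Subset v)

AllOfSize : ∀ {v} → ℕ → Blocks v → Set
AllOfSize k 𝓑 = All (λ B → ∣ B ∣ ≡ k) 𝓑

IsCover : (v k t m : ℕ) → Blocks v → Set
IsCover v k t m 𝓑 =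
  AllOfSize k 𝓑 ×
  ((S : Subset v) → ∣ S ∣ ≡ m → ∃ λ B → B LMem.∈ 𝓑 × t ≤ ∣ S ∩ B ∣)

IsCoveringDesign : (v k t : ℕ) → Blocks v → Set
IsCoveringDesign v k t 𝓑 =
  AllOfSize k 𝓑 ×
  ((S : Subset v) → ∣ S ∣ ≡ t → ∃ λ B → B LMem.∈ 𝓑 × S ⊆ B)

IsParallelClass : ∀ {v} → Blocks v → Set
IsParallelClass {v} C =
  (x : Fin v) → Σ (Fin (length C)) λ j →
    (x ∈ lookup C j) × ((j' : Fin (length C)) → x ∈ lookup C j' → j' ≡ j)

IsResolvableCoveringDesign : (v k t p : ℕ) → Vec (Blocks v) p → Set
IsResolvableCoveringDesign v k t p classes =
  All IsParallelClass (Vec.toList classes) ×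
  IsCoveringDesign v k t (concat (Vec.toList classes))

-- The point set X = Fin (n + n); X₁ = first n points, X₂ = last n points.
-- Embeddings of subsets of X₁, X₂ into X:
left : ∀ {n} → Subset n → Subset (n Data.Nat.+ n)
left {n} A = A ++ ⊥

right : ∀ {n} → Subset n → Subset (n Data.Nat.+ n)
right {n} B = ⊥ {n} ++ B

-- 𝓐𝓑 = { A ∪ B : A ∈ 𝓐, B ∈ 𝓑 } with A ⊆ X₁, B ⊆ X₂
prodBlocks : ∀ {n} → Blocks n → Blocks n → Blocks (n Data.Nat.+ n)
prodBlocks 𝓐 𝓑 = cartesianProductWith _++_ 𝓐 𝓑

combined : ∀ {n p} → Blocks n → Blocks n → Vec (Blocks n) p → Vec (Blocks n) p →
           Blocks (n Data.Nat.+ n)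
combined 𝓑₁ 𝓑₂ P R =
  List.map left 𝓑₁ List.++ List.map right 𝓑₂ List.++
  concat (Vec.toList (Vec.zipWith prodBlocks P R))

module Submission where

-- Let S be a 6-subset of X = X₁ ∪ X₂, written S = S₁ ++ S₂ with Sᵢ ⊆ Xᵢ, so
-- that |S₁| + |S₂| = 6.  If |S₁| ≥ 4, a 4-subset of S₁ lies in a block of 𝓑₁,
-- which then meets S in at least 4 points; |S₂| ≥ 4 is symmetric.  Otherwise
-- |S₁| = |S₂| = 3.  Each of the three pairs of S₁ lies in a block of some
-- class 𝓟ᵢ and each of the three pairs of S₂ in a block of some class 𝓡ᵢ.
-- These are six pairs but there are only p ≤ 5 class indices, so by the
-- pigeonhole principle two of the pairs share an index i.  Two pairs of S₁
-- share a point, so their blocks (of the parallel class 𝓟ᵢ) coincide and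
-- contain all of S₁; together with the block of 𝓡ᵢ through any point of S₂
-- this is a block of 𝓟ᵢ𝓡ᵢ meeting S in 3 + 1 points.  Two pairs of S₂ are
-- symmetric, and one pair from each side gives 2 + 2 points.

open import Defs
open import Data.Nat using (ℕ; zero; suc; _≤_; _<_; _*_; _+_; z≤n; s≤s; _≤?_)
open import Data.Nat.Properties
  using (≤-refl; ≤-trans; ≤-antisym; ≤-reflexive; ≤-pred; ≰⇒>; +-suc; +-identityʳ; +-comm;
         +-monoʳ-≤; +-mono-≤; +-cancelʳ-≤; n≤1+n; m≤m+n; m≤n+m)
open import Data.Fin using (Fin; zero; suc; punchIn; punchOut; splitAt; join)
open import Data.Fin.Properties
  using (suc-injective; 0≢1+n; ¬Fin0; _≟_; punchIn-injective; punchIn-punchOut;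
         pigeonhole; <⇒≢; join-splitAt)
open import Data.Fin.Subset
  using (Subset; ∣_∣; _⊆_; _∩_; _∪_; _∈_; _-_; ⊥; ⁅_⁆; inside; outside)
open import Data.Fin.Subset.Properties
  using (⊥⊆; ∣⊥∣≡0; ∣⁅x⁆∣≡1; x∈⁅x⁆; in⊆in; s⊆s; p⊆q⇒∣p∣≤∣q∣; x∈p∩q⁺;
         x∈p∪q⁺; x∈p⇒∣p-x∣<∣p∣; x∈p∧x≢y⇒x∈p-y)
open import Data.Bool using (_∧_)
open import Data.Vec as Vec using (Vec; []; _∷_; _++_; here; there)
open import Data.Vec.Properties using (zipWith-++)
open import Data.List as List using (concat)
open import Data.List.Membership.Propositional using () renaming (_∈_ to _∈ₗ_)
open import Data.List.Membership.Propositional.Properties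
  using (∈-++⁺ˡ; ∈-++⁺ʳ; ∈-++⁻; ∈-map⁺; ∈-lookup; ∈-cartesianProductWith⁺)
open import Data.List.Relation.Unary.All as All using (All; []; _∷_)
import Data.List.Relation.Unary.All.Properties as AllP
import Data.List.Relation.Unary.Any as Any
open import Data.List.Relation.Unary.Any.Properties using (lookup-index)
open import Data.Product using (Σ; ∃; _×_; _,_; proj₁; proj₂)
open import Data.Sum using (inj₁; inj₂; [_,_]′)
open import Data.Empty using (⊥-elim)
open import Relation.Nullary using (yes; no)
open import Relation.Binary.PropositionalEquality
open import Function using (_∘_)
open import Function.Definitions using (Injective)

Points : ∀ {n} → ℕ → Subset n → Set
Points {n} m A = Σ (Fin m → Fin n) λ f → Injective _≡_ _≡_ f × (∀ l → f l ∈ A)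

points⇒≤∣∣ : ∀ {n m} {A : Subset n} → Points m A → m ≤ ∣ A ∣
points⇒≤∣∣ {m = zero} _ = z≤n
points⇒≤∣∣ {m = suc m} {A} (f , inj , f∈A) =
  ≤-trans (s≤s (points⇒≤∣∣ (f ∘ suc , suc-injective ∘ inj , others)))
          (x∈p⇒∣p-x∣<∣p∣ (f∈A zero))
  where
  others : ∀ l → f (suc l) ∈ A - f zero
  others l = x∈p∧x≢y⇒x∈p-y (f∈A (suc l)) (λ e → 0≢1+n (sym (inj e)))

enumerate : ∀ {n m} (A : Subset n) → m ≤ ∣ A ∣ → Points m A
enumerate {m = zero} _ _ = (λ ()) , (λ {x} → ⊥-elim (¬Fin0 x)) , λ ()
enumerate {m = suc m} (inside ∷ A) (s≤s m≤∣A∣) with enumerate A m≤∣A∣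
... | f , inj , f∈A = g , g-injective , g∈
  where
  g : Fin (suc m) → Fin _
  g zero = zero
  g (suc l) = suc (f l)
  g-injective : Injective _≡_ _≡_ g
  g-injective {zero} {zero} _ = refl
  g-injective {suc l} {suc l'} e = cong suc (inj (suc-injective e))
  g∈ : ∀ l → g l ∈ inside ∷ A
  g∈ zero = here
  g∈ (suc l) = there (f∈A l)
enumerate {m = suc m} (outside ∷ A) m≤∣A∣ with enumerate A m≤∣A∣
... | f , inj , f∈A = suc ∘ f , inj ∘ suc-injective , there ∘ f∈A

shrink : ∀ {n m} (A : Subset n) → m ≤ ∣ A ∣ → ∃ λ T → T ⊆ A × ∣ T ∣ ≡ m
shrink {n} {zero} _ _ = ⊥ , ⊥⊆ , ∣⊥∣≡0 n
shrink {m = suc m} (inside ∷ A) (s≤s m≤∣A∣) with shrink A m≤∣A∣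
... | T , T⊆A , ∣T∣≡m = inside ∷ T , in⊆in T⊆A , cong suc ∣T∣≡m
shrink {m = suc m} (outside ∷ A) m≤∣A∣ with shrink A m≤∣A∣
... | T , T⊆A , ∣T∣≡m = outside ∷ T , s⊆s T⊆A , ∣T∣≡m

∣p∪q∣≤∣p∣+∣q∣ : ∀ {n} (p q : Subset n) → ∣ p ∪ q ∣ ≤ ∣ p ∣ + ∣ q ∣
∣p∪q∣≤∣p∣+∣q∣ [] [] = z≤n
∣p∪q∣≤∣p∣+∣q∣ (outside ∷ p) (outside ∷ q) = ∣p∪q∣≤∣p∣+∣q∣ p q
∣p∪q∣≤∣p∣+∣q∣ (inside ∷ p) (outside ∷ q) = s≤s (∣p∪q∣≤∣p∣+∣q∣ p q)
∣p∪q∣≤∣p∣+∣q∣ (outside ∷ p) (inside ∷ q) =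
  ≤-trans (s≤s (∣p∪q∣≤∣p∣+∣q∣ p q)) (≤-reflexive (sym (+-suc ∣ p ∣ ∣ q ∣)))
∣p∪q∣≤∣p∣+∣q∣ (inside ∷ p) (inside ∷ q) =
  s≤s (≤-trans (∣p∪q∣≤∣p∣+∣q∣ p q) (+-monoʳ-≤ ∣ p ∣ (n≤1+n ∣ q ∣)))

pair : ∀ {n} → (Fin 2 → Fin n) → Subset n
pair f = ⁅ f zero ⁆ ∪ ⁅ f (suc zero) ⁆

∈pair : ∀ {n} (f : Fin 2 → Fin n) l → f l ∈ pair f
∈pair f zero = x∈p∪q⁺ (inj₁ (x∈⁅x⁆ (f zero)))
∈pair f (suc zero) = x∈p∪q⁺ (inj₂ (x∈⁅x⁆ (f (suc zero))))

∣pair∣ : ∀ {n} (f : Fin 2 → Fin n) → Injective _≡_ _≡_ f → ∣ pair f ∣ ≡ 2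
∣pair∣ f inj = ≤-antisym upper (points⇒≤∣∣ (f , inj , ∈pair f))
  where
  upper : ∣ pair f ∣ ≤ 2
  upper = ≤-trans (∣p∪q∣≤∣p∣+∣q∣ ⁅ f zero ⁆ ⁅ f (suc zero) ⁆)
                  (≤-reflexive (cong₂ _+_ (∣⁅x⁆∣≡1 (f zero)) (∣⁅x⁆∣≡1 (f (suc zero)))))

omit : ∀ {n m} {S : Subset n} → Points (suc m) S → Fin (suc m) → Points m S
omit (f , inj , f∈S) j = f ∘ punchIn j , punchIn-injective j _ _ ∘ inj , f∈S ∘ punchIn j

∣++∣ : ∀ {m n} (A : Subset m) (B : Subset n) → ∣ A ++ B ∣ ≡ ∣ A ∣ + ∣ B ∣
∣++∣ [] B = refl
∣++∣ (inside ∷ A) B = cong suc (∣++∣ A B)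
∣++∣ (outside ∷ A) B = ∣++∣ A B

∣++∩++∣ : ∀ {m n} (S₁ A : Subset m) (S₂ C : Subset n) →
          ∣ (S₁ ++ S₂) ∩ (A ++ C) ∣ ≡ ∣ S₁ ∩ A ∣ + ∣ S₂ ∩ C ∣
∣++∩++∣ S₁ A S₂ C =
  trans (cong ∣_∣ (zipWith-++ _∧_ S₁ S₂ A C)) (∣++∣ (S₁ ∩ A) (S₂ ∩ C))

sameBlock : ∀ {n} {C : Blocks n} → IsParallelClass C → ∀ {A A' x} →
            A ∈ₗ C → A' ∈ₗ C → x ∈ A → x ∈ A' → A ≡ A'
sameBlock {C = C} par {A} {A'} {x} A∈C A'∈C x∈A x∈A' with par x
... | j , _ , unique = begin
  A                                ≡⟨ lookup-index A∈C ⟩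
  List.lookup C (Any.index A∈C)    ≡⟨ cong (List.lookup C) (trans (index≡ A∈C x∈A)
                                                               (sym (index≡ A'∈C x∈A'))) ⟩
  List.lookup C (Any.index A'∈C)   ≡⟨ lookup-index A'∈C ⟨
  A'                               ∎
  where
  open ≡-Reasoning
  index≡ : ∀ {B} (B∈C : B ∈ₗ C) → x ∈ B → Any.index B∈C ≡ j
  index≡ B∈C x∈B = unique (Any.index B∈C) (subst (x ∈_) (lookup-index B∈C) x∈B)

pointBlock : ∀ {n} {C : Blocks n} → IsParallelClass C → (x : Fin n) →
             ∃ λ A → A ∈ₗ C × x ∈ A
pointBlock {C = C} par x with par x
... | j , x∈ , _ = List.lookup C j , ∈-lookup j , x∈

lookupAll : ∀ {A : Set} {Q : A → Set} {p} (xs : Vec A p) →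
            All Q (Vec.toList xs) → ∀ i → Q (Vec.lookup xs i)
lookupAll (x ∷ xs) (qx ∷ _) zero = qx
lookupAll (x ∷ xs) (_ ∷ qxs) (suc i) = lookupAll xs qxs i

classOf : ∀ {n p} (Q : Vec (Blocks n) p) {B} →
          B ∈ₗ concat (Vec.toList Q) → ∃ λ i → B ∈ₗ Vec.lookup Q i
classOf (C ∷ Q) B∈ with ∈-++⁻ C B∈
... | inj₁ B∈C = zero , B∈C
... | inj₂ B∈rest with classOf Q B∈rest
... | i , B∈Qi = suc i , B∈Qi

Contains : ∀ {n p m} → Vec (Blocks n) p → (Fin m → Fin n) → Fin p → Set
Contains Q g i = ∃ λ A → A ∈ₗ Vec.lookup Q i × (∀ l → g l ∈ A)

Meets : ∀ {n p} → Vec (Blocks n) p → Subset n → Fin p → ℕ → Set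
Meets Q S i c = ∃ λ A → A ∈ₗ Vec.lookup Q i × c ≤ ∣ S ∩ A ∣

containsMeets : ∀ {n p m} {Q : Vec (Blocks n) p} {S : Subset n} {i} →
                (pts : Points m S) → Contains Q (proj₁ pts) i → Meets Q S i m
containsMeets (f , inj , f∈S) (A , A∈ , f∈A) =
  A , A∈ , points⇒≤∣∣ (f , inj , λ l → x∈p∩q⁺ (f∈S l , f∈A l))

classMeets : ∀ {n p m} {Q : Vec (Blocks n) p} {S : Subset n} {i} →
             IsParallelClass (Vec.lookup Q i) → Points (suc m) S → Meets Q S i 1
classMeets par (f , _ , f∈S) with pointBlock par (f zero)
... | A , A∈ , x∈A =
  A , A∈ , points⇒≤∣∣ ((λ _ → f zero) , (λ { {zero} {zero} _ → refl }) ,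
                        λ _ → x∈p∩q⁺ (f∈S zero , x∈A))

pairClass : ∀ {n h p} (Q : Vec (Blocks n) p) →
            IsCoveringDesign n h 2 (concat (Vec.toList Q)) →
            (f : Fin 2 → Fin n) → Injective _≡_ _≡_ f → ∃ (Contains Q f)
pairClass Q (_ , covers) f inj with covers (pair f) (∣pair∣ f inj)
... | B , B∈ , pair⊆B with classOf Q B∈
... | i , B∈Qi = i , B , B∈Qi , pair⊆B ∘ ∈pair f

avoiding : ∀ {n m} {g : Fin (suc m) → Fin n} {A : Subset n} {j} →
           (∀ l → g (punchIn j l) ∈ A) → ∀ {x} → j ≢ x → g x ∈ A
avoiding {g = g} {A} g∈A j≢x =
  subst (λ y → g y ∈ A) (punchIn-punchOut j≢x) (g∈A (punchOut j≢x))

thirdIndex : ∀ {m} (j j' : Fin (3 + m)) → ∃ λ l → j' ≢ punchIn j l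
thirdIndex j j' with j' ≟ punchIn j zero
... | no j'≢ = zero , j'≢
... | yes j'≡ = suc zero ,
  λ j'≡' → 0≢1+n (punchIn-injective j _ _ (trans (sym j'≡) j'≡'))

-- Two blocks of one parallel class containing all points of g but the j-th,
-- resp. all but the j'-th (j ≢ j'), share a point; so they coincide and the
-- block contains every point of g.
mergeBlocks : ∀ {n p m} {Q : Vec (Blocks n) p} {i} {g : Fin (3 + m) → Fin n} {j j'} →
              IsParallelClass (Vec.lookup Q i) → j ≢ j' →
              Contains Q (g ∘ punchIn j) i → Contains Q (g ∘ punchIn j') i →
              Contains Q g i
mergeBlocks {g = g} {j} {j'} par j≢j' (A , A∈ , gA) (A' , A'∈ , gA')
  with thirdIndex j j'
... | l , j'≢ = A , A∈ , everywhere
  where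
  A≡A' : A ≡ A'
  A≡A' = sameBlock par A∈ A'∈ (gA l) (avoiding {g = g} gA' j'≢)
  everywhere : ∀ x → g x ∈ A
  everywhere x with j ≟ x
  ... | no j≢x = avoiding {g = g} gA j≢x
  ... | yes refl = subst (g x ∈_) (sym A≡A') (avoiding {g = g} gA' (j≢j' ∘ sym))

data Collision {p m₁ m₂} (f₁ : Fin m₁ → Fin p) (f₂ : Fin m₂ → Fin p) : Set where
  within₁ : ∀ {j j'} → j ≢ j' → f₁ j ≡ f₁ j' → Collision f₁ f₂
  within₂ : ∀ {j j'} → j ≢ j' → f₂ j ≡ f₂ j' → Collision f₁ f₂
  across  : ∀ {j j'} → f₁ j ≡ f₂ j' → Collision f₁ f₂

collision : ∀ {p m₁ m₂} → p < m₁ + m₂ →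
            (f₁ : Fin m₁ → Fin p) (f₂ : Fin m₂ → Fin p) → Collision f₁ f₂
collision {m₁ = m₁} {m₂} p<m f₁ f₂ with pigeonhole p<m ([ f₁ , f₂ ]′ ∘ splitAt m₁)
... | x , y , x<y , fx≡fy = sort (<⇒≢ x<y ∘ splitAt-injective) fx≡fy
  where
  splitAt-injective : splitAt m₁ x ≡ splitAt m₁ y → x ≡ y
  splitAt-injective e = trans (sym (join-splitAt m₁ m₂ x))
                              (trans (cong (join m₁ m₂) e) (join-splitAt m₁ m₂ y))
  sort : ∀ {u v} → u ≢ v → [ f₁ , f₂ ]′ u ≡ [ f₁ , f₂ ]′ v → Collision f₁ f₂
  sort {inj₁ j} {inj₁ j'} u≢v e = within₁ (u≢v ∘ cong inj₁) e
  sort {inj₂ j} {inj₂ j'} u≢v e = within₂ (u≢v ∘ cong inj₂) e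
  sort {inj₁ j} {inj₂ j'} _ e = across e
  sort {inj₂ j} {inj₁ j'} _ e = across (sym e)

coveringMeets : ∀ {n k t} {𝓑 : Blocks n} → IsCoveringDesign n k t 𝓑 →
                (S : Subset n) → t ≤ ∣ S ∣ → ∃ λ B → B ∈ₗ 𝓑 × t ≤ ∣ S ∩ B ∣
coveringMeets (_ , covers) S t≤∣S∣ with shrink S t≤∣S∣
... | T , T⊆S , ∣T∣≡t with covers T ∣T∣≡t
... | B , B∈ , T⊆B =
  B , B∈ , subst (_≤ ∣ S ∩ B ∣) ∣T∣≡t
                 (p⊆q⇒∣p∣≤∣q∣ (λ x∈T → x∈p∩q⁺ (T⊆S x∈T , T⊆B x∈T)))

≤-fromSum : ∀ {a b m n} → a + b ≡ m + n → b ≤ n → m ≤ a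
≤-fromSum {a} {b} {m} {n} e b≤n =
  +-cancelʳ-≤ n m a (≤-trans (≤-reflexive (sym e)) (+-monoʳ-≤ a b≤n))

∣left∣ : ∀ {n} (B : Subset n) → ∣ left B ∣ ≡ ∣ B ∣
∣left∣ {n} B = trans (∣++∣ B ⊥) (trans (cong (∣ B ∣ +_) (∣⊥∣≡0 n)) (+-identityʳ ∣ B ∣))

∣right∣ : ∀ {n} (B : Subset n) → ∣ right B ∣ ≡ ∣ B ∣
∣right∣ {n} B = trans (∣++∣ (⊥ {n}) B) (cong (_+ ∣ B ∣) (∣⊥∣≡0 n))

productIn : ∀ {n p} (P R : Vec (Blocks n) p) (i : Fin p) {A C} →
            A ∈ₗ Vec.lookup P i → C ∈ₗ Vec.lookup R i →
            (A ++ C) ∈ₗ concat (Vec.toList (Vec.zipWith prodBlocks P R))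
productIn (X ∷ P) (Y ∷ R) zero A∈ C∈ = ∈-++⁺ˡ (∈-cartesianProductWith⁺ _++_ A∈ C∈)
productIn (X ∷ P) (Y ∷ R) (suc i) A∈ C∈ = ∈-++⁺ʳ (prodBlocks X Y) (productIn P R i A∈ C∈)

productSizes : ∀ {n p a b} (P R : Vec (Blocks n) p) →
               AllOfSize a (concat (Vec.toList P)) → AllOfSize b (concat (Vec.toList R)) →
               AllOfSize (a + b) (concat (Vec.toList (Vec.zipWith prodBlocks P R)))
productSizes [] [] _ _ = []
productSizes {a = a} {b} (X ∷ P) (Y ∷ R) sizesP sizesR =
  AllP.++⁺ (AllP.cartesianProductWith⁺ (setoid _) (setoid _) _++_ X Y joined)
           (productSizes P R (AllP.++⁻ʳ X sizesP) (AllP.++⁻ʳ Y sizesR))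
  where
  joined : ∀ {A C} → A ∈ₗ X → C ∈ₗ Y → ∣ A ++ C ∣ ≡ a + b
  joined {A} {C} A∈ C∈ = trans (∣++∣ A C)
    (cong₂ _+_ (All.lookup (AllP.++⁻ˡ X sizesP) A∈) (All.lookup (AllP.++⁻ˡ Y sizesR) C∈))

combinedSizes : ∀ {n p k h h'} {𝓑₁ 𝓑₂ : Blocks n} (P R : Vec (Blocks n) p) →
                k ≡ h + h' → AllOfSize k 𝓑₁ → AllOfSize k 𝓑₂ →
                AllOfSize h (concat (Vec.toList P)) → AllOfSize h' (concat (Vec.toList R)) →
                AllOfSize k (combined 𝓑₁ 𝓑₂ P R)
combinedSizes P R k≡ sizes₁ sizes₂ sizesP sizesR =
  AllP.++⁺ (AllP.map⁺ (All.map (λ {B} e → trans (∣left∣ B) e) sizes₁))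
  (AllP.++⁺ (AllP.map⁺ (All.map (λ {B} e → trans (∣right∣ B) e) sizes₂))
            (subst (λ k → AllOfSize k _) (sym k≡) (productSizes P R sizesP sizesR)))

module SplitSubset {n p} (P R : Vec (Blocks n) p) (𝓑₁ 𝓑₂ : Blocks n)
                   (S₁ S₂ : Subset n) where

  Witness : Set
  Witness = ∃ λ B → B ∈ₗ combined 𝓑₁ 𝓑₂ P R × 4 ≤ ∣ (S₁ ++ S₂) ∩ B ∣

  leftWitness : (∃ λ B → B ∈ₗ 𝓑₁ × 4 ≤ ∣ S₁ ∩ B ∣) → Witness
  leftWitness (B , B∈ , 4≤) =
    left B , ∈-++⁺ˡ (∈-map⁺ left B∈) ,
    subst (4 ≤_) (sym (∣++∩++∣ S₁ B S₂ ⊥)) (≤-trans 4≤ (m≤m+n _ _))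

  rightWitness : (∃ λ B → B ∈ₗ 𝓑₂ × 4 ≤ ∣ S₂ ∩ B ∣) → Witness
  rightWitness (B , B∈ , 4≤) =
    right B , ∈-++⁺ʳ (List.map left 𝓑₁) (∈-++⁺ˡ (∈-map⁺ right B∈)) ,
    subst (4 ≤_) (sym (∣++∩++∣ S₁ ⊥ S₂ B)) (≤-trans 4≤ (m≤n+m _ _))

  productWitness : ∀ {i a c} → Meets P S₁ i a → Meets R S₂ i c → 4 ≤ a + c → Witness
  productWitness {i} (A , A∈ , a≤) (C , C∈ , c≤) 4≤ =
    A ++ C ,
    ∈-++⁺ʳ (List.map left 𝓑₁) (∈-++⁺ʳ (List.map right 𝓑₂) (productIn P R i A∈ C∈)) ,
    subst (4 ≤_) (sym (∣++∩++∣ S₁ A S₂ C)) (≤-trans 4≤ (+-mono-≤ a≤ c≤))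

  module Balanced {h h'} (rP : IsResolvableCoveringDesign n h 2 p P)
                  (rR : IsResolvableCoveringDesign n h' 2 p R)
                  (t₁ : Points 3 S₁) (t₂ : Points 3 S₂) where

    pairs₁ : (j : Fin 3) → ∃ (Contains P (proj₁ (omit t₁ j)))
    pairs₁ j = pairClass P (proj₂ rP) _ (proj₁ (proj₂ (omit t₁ j)))

    pairs₂ : (j : Fin 3) → ∃ (Contains R (proj₁ (omit t₂ j)))
    pairs₂ j = pairClass R (proj₂ rR) _ (proj₁ (proj₂ (omit t₂ j)))

    -- two pairs in classes with the same index give 3 + 1, 1 + 3 or 2 + 2 points
    fromCollision : Collision (proj₁ ∘ pairs₁) (proj₁ ∘ pairs₂) → Witness
    fromCollision (within₁ {j} {j'} j≢j' e) = productWitness {i = proj₁ (pairs₁ j)}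
      (containsMeets {Q = P} t₁
        (mergeBlocks {Q = P} {g = proj₁ t₁} (lookupAll P (proj₁ rP) _) j≢j'
          (proj₂ (pairs₁ j)) (subst (Contains P _) (sym e) (proj₂ (pairs₁ j')))))
      (classMeets {Q = R} (lookupAll R (proj₁ rR) _) t₂) ≤-refl
    fromCollision (within₂ {j} {j'} j≢j' e) = productWitness {i = proj₁ (pairs₂ j)}
      (classMeets {Q = P} (lookupAll P (proj₁ rP) _) t₁)
      (containsMeets {Q = R} t₂
        (mergeBlocks {Q = R} {g = proj₁ t₂} (lookupAll R (proj₁ rR) _) j≢j'
          (proj₂ (pairs₂ j)) (subst (Contains R _) (sym e) (proj₂ (pairs₂ j'))))) ≤-refl
    fromCollision (across {j} {j'} e) = productWitness {i = proj₁ (pairs₁ j)}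
      (containsMeets {Q = P} (omit t₁ j) (proj₂ (pairs₁ j)))
      (containsMeets {Q = R} (omit t₂ j') (subst (Contains R _) (sym e) (proj₂ (pairs₂ j'))))
      ≤-refl

    -- six pairs but at most five class indices
    witness : p ≤ 5 → Witness
    witness p≤5 = fromCollision (collision (s≤s p≤5) _ _)

  -- |S₁| + |S₂| = 6: either one side has four points, or both have three.
  witness : ∀ {k h h'} → IsCoveringDesign n k 4 𝓑₁ → IsCoveringDesign n k 4 𝓑₂ →
            IsResolvableCoveringDesign n h 2 p P → IsResolvableCoveringDesign n h' 2 p R →
            p ≤ 5 → ∣ S₁ ∣ + ∣ S₂ ∣ ≡ 6 → Witness
  witness c₁ c₂ rP rR p≤5 ∣S∣≡6 with 4 ≤? ∣ S₁ ∣ | 4 ≤? ∣ S₂ ∣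
  ... | yes 4≤∣S₁∣ | _ = leftWitness (coveringMeets c₁ S₁ 4≤∣S₁∣)
  ... | no _ | yes 4≤∣S₂∣ = rightWitness (coveringMeets c₂ S₂ 4≤∣S₂∣)
  ... | no ∣S₁∣≱4 | no ∣S₂∣≱4 = Balanced.witness rP rR
    (enumerate S₁ (≤-fromSum {m = 3} ∣S∣≡6 (≤-pred (≰⇒> ∣S₂∣≱4))))
    (enumerate S₂ (≤-fromSum {m = 3} (trans (+-comm ∣ S₂ ∣ ∣ S₁ ∣) ∣S∣≡6) (≤-pred (≰⇒> ∣S₁∣≱4))))
    p≤5

-- Split a 6-subset of X along X = X₁ ++ X₂ and apply the case analysis.
-- The hypotheses 4 ≤ k and k ≤ n only exclude degenerate parameters; the
-- argument does not need them.
theorem16 : (n k h p : ℕ) → 4 ≤ k → k ≡ 2 * h → k ≤ n → p ≤ 5 →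
    (P R : Vec (Blocks n) p) →
    IsResolvableCoveringDesign n h 2 p P →
    IsResolvableCoveringDesign n h 2 p R →
    (𝓑₁ 𝓑₂ : Blocks n) →
    IsCoveringDesign n k 4 𝓑₁ →
    IsCoveringDesign n k 4 𝓑₂ →
    IsCover (n + n) k 4 6 (combined 𝓑₁ 𝓑₂ P R)
theorem16 n k h p _ k≡2h _ p≤5 P R rP rR 𝓑₁ 𝓑₂ c₁ c₂ =
  combinedSizes P R k≡h+h (proj₁ c₁) (proj₁ c₂) (proj₁ (proj₂ rP)) (proj₁ (proj₂ rR)) ,
  cover
  where
  k≡h+h : k ≡ h + h
  k≡h+h = trans k≡2h (cong (h +_) (+-identityʳ h))
  cover : (S : Subset (n + n)) → ∣ S ∣ ≡ 6 →
          ∃ λ B → B ∈ₗ combined 𝓑₁ 𝓑₂ P R × 4 ≤ ∣ S ∩ B ∣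
  cover S ∣S∣≡6 with Vec.splitAt n S
  ... | S₁ , S₂ , refl = SplitSubset.witness P R 𝓑₁ 𝓑₂ S₁ S₂ c₁ c₂ rP rR p≤5
                           (trans (sym (∣++∣ S₁ S₂)) ∣S∣≡6)
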